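{- For every integer $n\ge 9$, ${\rm ic}(C_n\bar{C}_n)\ge \frac{7}{9}n-12$.
   Context: $C_n$ is the cycle of order $n$. The complementary prism $H\bar{H}$ of a graph $H$ with vertices $v_1,\ldots,v_n$ is the disjoint union of $H$ and its complement $\bar H$ (on vertices $\bar v_1,\ldots,\bar v_n$, where $\bar v_i\bar v_j$ is an edge iff $v_iv_j$ is not an edge of $H$) together with the perfect matching $v_1\bar v_1,\ldots,v_n\bar v_n$. A set $D$ of vertices of a graph $G$ is an identifying code if the sets $N_G[u]\cap D$ (where $N_G[u]$ is the closed neighborhood of $u$) are non-empty and pairwise distinct over all vertices $u$ of $G$; ${\rm ic}(G)$ denotes the minimum order of an identifying code in $G$. -}

module Defs where

open import Data.Nat using (ℕ; zero; suc)
open import Data.Fin using (Fin; toℕ)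
open import Data.Fin.Subset using (Subset; _∈_; _∉_; ∣_∣)
open import Data.Sum using (_⊎_; inj₁; inj₂)
open import Data.Product using (_×_; ∃)
open import Data.Empty using (⊥)
open import Relation.Nullary using (¬_)
open import Relation.Binary.PropositionalEquality using (_≡_; _≢_)

InClosedNbhd : {V : Set} → (V → V → Set) → V → V → Set
InClosedNbhd Adj u v = (v ≡ u) ⊎ Adj u v

record IsIdentifyingCode {V : Set} (Adj : V → V → Set) (InD : V → Set) : Set where
  field
    nonempty : ∀ u → ∃ λ v → InD v × InClosedNbhd Adj u v
    separating : ∀ u w → u ≢ w →
      ∃ λ v → InD v ×
        ((InClosedNbhd Adj u v × ¬ InClosedNbhd Adj w v)
         ⊎ (InClosedNbhd Adj w v × ¬ InClosedNbhd Adj u v))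

CycSucc : (n : ℕ) → Fin n → Fin n → Set
CycSucc n i j = (suc (toℕ i) ≡ toℕ j) ⊎ ((suc (toℕ i) ≡ n) × (toℕ j ≡ 0))

CycleAdj : (n : ℕ) → Fin n → Fin n → Set
CycleAdj n i j = CycSucc n i j ⊎ CycSucc n j i

-- Complementary prism H H̄ of a graph H on Fin n:
-- inj₁ i = v_i (copy of H), inj₂ i = v̄_i (copy of the complement).
PrismAdj : (n : ℕ) → (Fin n → Fin n → Set) → (Fin n ⊎ Fin n) → (Fin n ⊎ Fin n) → Set
PrismAdj n H (inj₁ i) (inj₁ j) = H i j
PrismAdj n H (inj₂ i) (inj₂ j) = (i ≢ j) × ¬ H i j
PrismAdj n H (inj₁ i) (inj₂ j) = i ≡ j
PrismAdj n H (inj₂ i) (inj₁ j) = i ≡ j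

-- A vertex subset of H H̄ is a pair (D₁, D₂) of subsets of Fin n
-- (D₁ ⊆ V(H), D₂ ⊆ V(H̄)); its order is ∣ D₁ ∣ + ∣ D₂ ∣.
InPair : {n : ℕ} → Subset n → Subset n → (Fin n ⊎ Fin n) → Set
InPair D₁ D₂ (inj₁ i) = i ∈ D₁
InPair D₁ D₂ (inj₂ i) = i ∈ D₂

-- Read an identifying code D of C_n C̄_n along the cycle as two binary
-- sequences x_t = [v_t ∈ D] and y_t = [v̄_t ∈ D].  Domination of v_t and
-- separation of the pairs (v_t, v_{t+1}), (v_t, v_{t+2}), (v̄_t, v̄_{t+2})
-- constrain every five consecutive positions.  Call t isolated if
-- v_t, v̄_{t-1}, v̄_{t+1} ∉ D; then N[v̄_t] ∩ D is exactly the part of D in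
-- C̄_n, so at most one position is isolated.  A potential ψ on windows of
-- four positions satisfies
--   7 + ψ(window t+1) ≤ 9 (x_t + y_t) + ψ(window t) + 7 [t+1 isolated]
-- for every admissible pattern of five positions (checked exhaustively), and
-- summing this around the cycle gives 7n ≤ 9|D| + 7.
module Submission where

open import Defs
open import Data.Nat using (ℕ; _+_; _*_; _≤_)
open import Data.Fin.Subset using (Subset; ∣_∣)

open import Data.Nat using (zero; suc; _<_; _%_; _≤ᵇ_; NonZero; z≤n; s≤s; >-nonZero)
open import Data.Nat.Properties
open import Data.Nat.DivMod using (_mod_; m%n<n; m<n⇒m%n≡m; [m+n]%n≡m%n; %-distribˡ-+; m%n%n≡m%n; n%n≡0)
open import Data.Nat.Tactic.RingSolver using (solve-∀)
open import Data.Fin as Fin using (Fin; toℕ)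
open import Data.Fin.Properties using (toℕ-injective; toℕ-fromℕ<; toℕ<n)
open import Data.Vec using (Vec; []; _∷_; lookup)
open import Data.Vec.Properties using ([]=⇒lookup)
open import Data.Bool using (Bool; true; false; not; _∧_; _∨_; T)
open import Data.Bool.Properties using (T-∧)
open import Data.Bool.ListAction using (or; any)
open import Data.List using (List; []; _∷_; _++_)
open import Data.List.Relation.Unary.Any using (Any; here; there)
open import Data.List.Relation.Unary.Any.Properties using (any⁺; ++⁺ˡ; ++⁺ʳ)
import Data.List.Relation.Unary.Any as Any
open import Data.List.Membership.Propositional using (_∈_; lose)
open import Data.Unit using (tt)
open import Data.Empty using (⊥; ⊥-elim)
open import Data.Sum using (_⊎_; inj₁; inj₂; swap)
open import Data.Sum.Properties using (inj₁-injective; inj₂-injective)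
open import Data.Product using (_,_; proj₁; proj₂)
open import Function using (_∘_; Equivalence)
open import Relation.Nullary using (¬_; yes; no)
open import Relation.Nullary.Decidable using (Dec; _⊎-dec_; _×-dec_)
open import Relation.Binary.PropositionalEquality

bit : Bool → ℕ
bit true  = 1
bit false = 0

T-not⇒¬T : ∀ {b} → T (not b) → ¬ T b
T-not⇒¬T {true} ()

T-modus-ponens : ∀ {a b} → T (not a ∨ b) → T a → T b
T-modus-ponens {true} h _ = h

∑< : ℕ → (ℕ → ℕ) → ℕ
∑< zero    f = 0
∑< (suc m) f = f 0 + ∑< m (f ∘ suc)

∑<-+ : ∀ m (f g : ℕ → ℕ) → ∑< m (λ t → f t + g t) ≡ ∑< m f + ∑< m g
∑<-+ zero    f g = refl
∑<-+ (suc m) f g = begin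
  f 0 + g 0 + ∑< m (λ t → f (suc t) + g (suc t)) ≡⟨ cong (f 0 + g 0 +_) (∑<-+ m (f ∘ suc) (g ∘ suc)) ⟩
  f 0 + g 0 + (∑< m (f ∘ suc) + ∑< m (g ∘ suc))  ≡⟨ +-+-interchange (f 0) (g 0) _ _ ⟩
  f 0 + ∑< m (f ∘ suc) + (g 0 + ∑< m (g ∘ suc))  ∎
  where
  open ≡-Reasoning
  +-+-interchange : ∀ a b c d → a + b + (c + d) ≡ a + c + (b + d)
  +-+-interchange = solve-∀

∑<-* : ∀ m k (f : ℕ → ℕ) → ∑< m (λ t → k * f t) ≡ k * ∑< m f
∑<-* zero    k f = sym (*-zeroʳ k)
∑<-* (suc m) k f = trans (cong (k * f 0 +_) (∑<-* m k (f ∘ suc))) (sym (*-distribˡ-+ k (f 0) _))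

∑<-telescope : ∀ m k (p a : ℕ → ℕ) → (∀ t → k + p (suc t) ≤ a t + p t) →
  m * k + p m ≤ ∑< m a + p 0
∑<-telescope zero    k p a step = ≤-refl
∑<-telescope (suc m) k p a step = begin
  k + m * k + p (suc m)        ≡⟨ +-assoc k (m * k) _ ⟩
  k + (m * k + p (suc m))      ≤⟨ +-monoʳ-≤ k (∑<-telescope m k (p ∘ suc) (a ∘ suc) (step ∘ suc)) ⟩
  k + (S + p 1)                ≡⟨ shuffle k S (p 1) ⟩
  S + (k + p 1)                ≤⟨ +-monoʳ-≤ S (step 0) ⟩
  S + (a 0 + p 0)              ≡⟨ shuffle S (a 0) (p 0) ⟩
  a 0 + (S + p 0)              ≡⟨ +-assoc (a 0) S (p 0) ⟨
  a 0 + S + p 0                ∎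
  where
  open ≤-Reasoning
  S = ∑< m (a ∘ suc)
  shuffle : ∀ x y z → x + (y + z) ≡ y + (x + z)
  shuffle = solve-∀

∑<-bit-none : ∀ m (β : ℕ → Bool) → (∀ {t} → t < m → ¬ T (β t)) → ∑< m (bit ∘ β) ≡ 0
∑<-bit-none zero    β none = refl
∑<-bit-none (suc m) β none with β 0 in β0
... | true  = ⊥-elim (none (s≤s z≤n) (subst T (sym β0) tt))
... | false = ∑<-bit-none m (β ∘ suc) (none ∘ s≤s)

∑<-bit-≤1 : ∀ m (β : ℕ → Bool) → (∀ {t t'} → t < m → t' < m → T (β t) → T (β t') → t ≡ t') →
  ∑< m (bit ∘ β) ≤ 1
∑<-bit-≤1 zero    β unique = z≤n
∑<-bit-≤1 (suc m) β unique with β 0 in β0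
... | true  = ≤-reflexive (cong suc (∑<-bit-none m (β ∘ suc) λ t<m βt →
                0≢1+n (unique (s≤s z≤n) (s≤s t<m) (subst T (sym β0) tt) βt)))
... | false = ∑<-bit-≤1 m (β ∘ suc) λ t<m t'<m βt βt' →
                suc-injective (unique (s≤s t<m) (s≤s t'<m) βt βt')

∑<-∣∣ : ∀ {n} (D : Subset n) (f : ℕ → ℕ) → (∀ i → f (toℕ i) ≡ bit (lookup D i)) → ∑< n f ≡ ∣ D ∣
∑<-∣∣ []          f hf = refl
∑<-∣∣ (true  ∷ D) f hf = cong₂ _+_ (hf Fin.zero) (∑<-∣∣ D (f ∘ suc) (hf ∘ Fin.suc))
∑<-∣∣ (false ∷ D) f hf = cong₂ _+_ (hf Fin.zero) (∑<-∣∣ D (f ∘ suc) (hf ∘ Fin.suc))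

allVec : ∀ k → (Vec Bool k → Bool) → Bool
allVec zero    f = f []
allVec (suc k) f = allVec k (f ∘ (true ∷_)) ∧ allVec k (f ∘ (false ∷_))

allVec-sound : ∀ k (f : Vec Bool k → Bool) → T (allVec k f) → ∀ v → T (f v)
allVec-sound zero    f h [] = h
allVec-sound (suc k) f h (true  ∷ v) = allVec-sound k _ (proj₁ (Equivalence.to T-∧ h)) v
allVec-sound (suc k) f h (false ∷ v) =
  allVec-sound k _ (proj₂ (Equivalence.to (T-∧ {allVec k (f ∘ (true ∷_))}) h)) v

-- ψ is the potential of the window x_t, y_t, …, x_{t+3}, y_{t+3}.  Its values
-- are shortest-path distances, shifted to be nonnegative, in the graph on
-- windows whose edges are the admissible five-position patterns weighted by
-- (cost − 7); they exist because that graph has no negative cycle.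
ψ : (xa ya xb yb xc yc xd yd : Bool) → ℕ
ψ true  true  true  _     _     _     _     _     = 0
ψ true  true  false true  _     true  _     _     = 0
ψ true  true  false true  _     false _     _     = 3
ψ true  true  false false true  true  _     _     = 0
ψ true  true  false false true  false _     _     = 3
ψ true  true  false false false true  _     _     = 2
ψ true  true  false false false false _     _     = 4
ψ true  false _     true  _     _     _     _     = 7
ψ true  false _     false true  _     _     _     = 7
ψ true  false true  false false _     _     _     = 9
ψ true  false false false false _     _     _     = 11
ψ false true  _     true  true  _     _     _     = 6
ψ false true  _     true  false _     _     true  = 6
ψ false true  true  true  false _     _     false = 8
ψ false true  false true  false true  _     false = 8
ψ false true  false true  false false _     false = 10
ψ false true  true  false _     _     _     _     = 8
ψ false true  false false _     true  _     _     = 8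
ψ false true  false false _     false _     _     = 12
ψ false false true  true  true  _     _     _     = 7
ψ false false true  true  false true  _     true  = 7
ψ false false true  true  false true  _     false = 10
ψ false false true  true  false false true  true  = 7
ψ false false true  true  false false true  false = 10
ψ false false true  true  false false false true  = 9
ψ false false true  true  false false false false = 11
ψ false false false true  _     _     _     _     = 13
ψ false false _     false _     _     _     _     = 14

potential-step? : Vec Bool 10 → Bool
potential-step? (xa ∷ ya ∷ xb ∷ yb ∷ xc ∷ yc ∷ xd ∷ yd ∷ xe ∷ ye ∷ []) =
  not (or (xa ∷ xb ∷ xc ∷ yb ∷ [])
       ∧ or (xa ∷ yb ∷ xd ∷ yc ∷ [])
       ∧ or (xa ∷ xb ∷ yb ∷ xe ∷ xd ∷ yd ∷ [])
       ∧ or (xb ∷ ye ∷ xd ∷ ya ∷ []))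
  ∨ (7 + ψ xb yb xc yc xd yd xe ye
       ≤ᵇ 9 * (bit xa + bit ya) + 7 * bit (not (or (xb ∷ ya ∷ yc ∷ []))) + ψ xa ya xb yb xc yc xd yd)

potential-step-holds : ∀ v → T (potential-step? v)
potential-step-holds = allVec-sound 10 potential-step? tt

module Sequences (x y : ℕ → Bool) where

  record LocallyIdentifying : Set where
    field
      dominated           : ∀ t → T (or (x t ∷ x (1 + t) ∷ x (2 + t) ∷ y (1 + t) ∷ []))
      separated-adjacent  : ∀ t → T (or (x t ∷ y (1 + t) ∷ x (3 + t) ∷ y (2 + t) ∷ []))
      separated-across    : ∀ t → T (or (x t ∷ x (1 + t) ∷ y (1 + t) ∷ x (4 + t) ∷ x (3 + t) ∷ y (3 + t) ∷ []))
      separated-copies    : ∀ t → T (or (x (1 + t) ∷ y (4 + t) ∷ x (3 + t) ∷ y t ∷ []))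

  weight : ℕ → ℕ
  weight t = bit (x t) + bit (y t)

  -- isolated t refers to position t + 1
  isolated : ℕ → Bool
  isolated t = not (or (x (1 + t) ∷ y t ∷ y (2 + t) ∷ []))

  potential : ℕ → ℕ
  potential t = ψ (x t) (y t) (x (1 + t)) (y (1 + t)) (x (2 + t)) (y (2 + t)) (x (3 + t)) (y (3 + t))

  cost : ℕ → ℕ
  cost t = 9 * weight t + 7 * bit (isolated t)

  potential-decrease : LocallyIdentifying → ∀ t → 7 + potential (suc t) ≤ cost t + potential t
  potential-decrease li t = ≤ᵇ⇒≤ _ _ (T-modus-ponens
    (potential-step-holds (x t ∷ y t ∷ x (1 + t) ∷ y (1 + t) ∷ x (2 + t) ∷ y (2 + t)
                             ∷ x (3 + t) ∷ y (3 + t) ∷ x (4 + t) ∷ y (4 + t) ∷ []))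
    (T-∧ .from (dominated t , T-∧ .from (separated-adjacent t ,
       T-∧ .from (separated-across t , separated-copies t)))))
    where
    open LocallyIdentifying li
    open Equivalence

  weight-bound : ∀ n → LocallyIdentifying →
    (∀ t → x (t + n) ≡ x t) → (∀ t → y (t + n) ≡ y t) →
    (∀ {t t'} → t < n → t' < n → T (isolated t) → T (isolated t') → t ≡ t') →
    7 * n ≤ 9 * ∑< n weight + 7
  weight-bound n li px py isolated-unique = +-cancelʳ-≤ (potential 0) _ _ (begin
    7 * n + potential 0                                         ≡⟨ cong₂ _+_ (*-comm 7 n) (sym potential-periodic) ⟩
    n * 7 + potential n                                         ≤⟨ ∑<-telescope n 7 potential cost (potential-decrease li) ⟩
    ∑< n cost + potential 0                                     ≡⟨ cong (_+ potential 0) ∑<-cost ⟩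
    9 * ∑< n weight + 7 * ∑< n (bit ∘ isolated) + potential 0   ≤⟨ +-monoˡ-≤ (potential 0) (+-monoʳ-≤ (9 * ∑< n weight)
                                                                     (*-monoʳ-≤ 7 (∑<-bit-≤1 n isolated isolated-unique))) ⟩
    9 * ∑< n weight + 7 + potential 0                           ∎)
    where
    open ≤-Reasoning
    potential-periodic : potential n ≡ potential 0
    potential-periodic rewrite px 0 | py 0 | px 1 | py 1 | px 2 | py 2 | px 3 | py 3 = refl
    ∑<-cost : ∑< n cost ≡ 9 * ∑< n weight + 7 * ∑< n (bit ∘ isolated)
    ∑<-cost = trans (∑<-+ n (λ t → 9 * weight t) (λ t → 7 * bit (isolated t)))
                    (cong₂ _+_ (∑<-* n 9 weight) (∑<-* n 7 (bit ∘ isolated)))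

module IdentifyingCode {V : Set} {Adj : V → V → Set} {InD : V → Set}
                       (code : IsIdentifyingCode Adj InD) where
  open IsIdentifyingCode code

  private
    N = InClosedNbhd Adj

  code-meets-nbhd-cover : ∀ {u} (L : List V) → (∀ {v} → N u v → v ∈ L) → Any InD L
  code-meets-nbhd-cover {u} L cover with nonempty u
  ... | v , v∈D , v∈N = lose (cover v∈N) v∈D

  code-meets-difference-cover : ∀ {u w} (L M : List V) → u ≢ w →
    (∀ {v} → N u v → ¬ N w v → v ∈ L) → (∀ {v} → N w v → ¬ N u v → v ∈ M) → Any InD (L ++ M)
  code-meets-difference-cover {u} {w} L M u≢w coverL coverM with separating u w u≢w
  ... | v , v∈D , inj₁ (Nu , ¬Nw) = ++⁺ˡ (lose (coverL Nu ¬Nw) v∈D)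
  ... | v , v∈D , inj₂ (Nw , ¬Nu) = ++⁺ʳ L (lose (coverM Nw ¬Nu) v∈D)

module Cycle (n : ℕ) where

  Succ = CycSucc n
  Adj  = CycleAdj n

  succ-unique : ∀ {i j j'} → Succ i j → Succ i j' → j ≡ j'
  succ-unique (inj₁ e) (inj₁ e') = toℕ-injective (trans (sym e) e')
  succ-unique {j = j} (inj₁ e) (inj₂ (e' , _)) = ⊥-elim (<-irrefl (trans (sym e) e') (toℕ<n j))
  succ-unique {j' = j'} (inj₂ (e , _)) (inj₁ e') = ⊥-elim (<-irrefl (trans (sym e') e) (toℕ<n j'))
  succ-unique (inj₂ (_ , z)) (inj₂ (_ , z')) = toℕ-injective (trans z (sym z'))

  pred-unique : ∀ {i i' j} → Succ i j → Succ i' j → i ≡ i'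
  pred-unique (inj₁ e) (inj₁ e') = toℕ-injective (suc-injective (trans e (sym e')))
  pred-unique (inj₁ e) (inj₂ (_ , z)) = ⊥-elim (0≢1+n (trans (sym z) (sym e)))
  pred-unique (inj₂ (_ , z)) (inj₁ e') = ⊥-elim (0≢1+n (trans (sym z) (sym e')))
  pred-unique (inj₂ (e , _)) (inj₂ (e' , _)) = toℕ-injective (suc-injective (trans e (sym e')))

  succ? : ∀ i j → Dec (Succ i j)
  succ? i j = (suc (toℕ i) ≟ toℕ j) ⊎-dec ((suc (toℕ i) ≟ n) ×-dec (toℕ j ≟ 0))

  adj? : ∀ i j → Dec (Adj i j)
  adj? i j = succ? i j ⊎-dec succ? j i

  Flanked : Fin n → Fin n → Fin n → Set
  Flanked a b c = ∀ {k} → Adj b k → k ≡ a ⊎ k ≡ c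

  flanked : ∀ {a b c} → Succ a b → Succ b c → Flanked a b c
  flanked ab bc (inj₁ bk) = inj₂ (succ-unique bk bc)
  flanked ab bc (inj₂ kb) = inj₁ (pred-unique kb ab)

  flanked-swap : ∀ {a b c} → Flanked a b c → Flanked c b a
  flanked-swap fl b~k = swap (fl b~k)

  module _ (3≤n : 3 ≤ n) where

    n≰2 : ¬ n ≤ 2
    n≰2 n≤2 = ≤⇒≯ n≤2 3≤n

    succ-irrefl : ∀ {i} → ¬ Succ i i
    succ-irrefl (inj₁ e) = 1+n≢n e
    succ-irrefl (inj₂ (e , z)) = n≰2 (≤-trans (≤-reflexive (trans (sym e) (cong suc z))) (n≤1+n 1))

    succ-asym : ∀ {i j} → Succ i j → ¬ Succ j i
    succ-asym (inj₁ e) (inj₁ e') = <-asym (≤-reflexive e) (≤-reflexive e')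
    succ-asym (inj₁ e) (inj₂ (e' , z)) = n≰2 (≤-reflexive (trans (sym e') (cong suc (trans (sym e) (cong suc z)))))
    succ-asym (inj₂ (e , z)) (inj₁ e') = n≰2 (≤-reflexive (trans (sym e) (cong suc (trans (sym e') (cong suc z)))))
    succ-asym (inj₂ (e , _)) (inj₂ (_ , z)) = succ-irrefl (inj₂ (e , z))

    adj-irrefl : ∀ {i} → ¬ Adj i i
    adj-irrefl (inj₁ s) = succ-irrefl s
    adj-irrefl (inj₂ s) = succ-irrefl s

module Prism (n : ℕ) where
  open Cycle n

  private
    N = InClosedNbhd (PrismAdj n Adj)

  outside-bottom-nbhd : ∀ {d k} → ¬ N (inj₂ d) (inj₂ k) → Adj d k
  outside-bottom-nbhd {d} {k} ¬N with adj? d k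
  ... | yes d~k = d~k
  ... | no  d≁k = ⊥-elim (¬N (inj₂ (d≢k , d≁k)))
    where
    d≢k : d ≢ k
    d≢k refl = ¬N (inj₁ refl)

  top-nbhd : ∀ {a b c v} → Flanked a b c → N (inj₁ b) v →
    v ∈ inj₁ a ∷ inj₁ b ∷ inj₁ c ∷ inj₂ b ∷ []
  top-nbhd fl (inj₁ refl) = there (here refl)
  top-nbhd {v = inj₁ k} fl (inj₂ b~k) with fl b~k
  ... | inj₁ refl = here refl
  ... | inj₂ refl = there (there (here refl))
  top-nbhd {v = inj₂ k} fl (inj₂ refl) = there (there (there (here refl)))

  top-only-adjacent : ∀ {a b c v} → Flanked a b c → Adj c b →
    N (inj₁ b) v → ¬ N (inj₁ c) v → v ∈ inj₁ a ∷ inj₂ b ∷ []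
  top-only-adjacent fl cb Nb ¬Nc with top-nbhd fl Nb
  ... | here refl                         = here refl
  ... | there (here refl)                 = ⊥-elim (¬Nc (inj₂ cb))
  ... | there (there (here refl))         = ⊥-elim (¬Nc (inj₁ refl))
  ... | there (there (there (here refl))) = there (here refl)

  top-only-across : ∀ {a b c d v} → Flanked a b c → Adj d c →
    N (inj₁ b) v → ¬ N (inj₁ d) v → v ∈ inj₁ a ∷ inj₁ b ∷ inj₂ b ∷ []
  top-only-across fl dc Nb ¬Nd with top-nbhd fl Nb
  ... | here refl                         = here refl
  ... | there (here refl)                 = there (here refl)
  ... | there (there (here refl))         = ⊥-elim (¬Nd (inj₂ dc))
  ... | there (there (there (here refl))) = there (there (here refl))

  bottom-only : ∀ {b p d s v} → Flanked p d s →
    N (inj₂ b) v → ¬ N (inj₂ d) v → v ≡ inj₁ b ⊎ v ∈ inj₂ p ∷ inj₂ s ∷ []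
  bottom-only {v = inj₁ k} fl (inj₂ refl) ¬Nd = inj₁ refl
  bottom-only {v = inj₂ k} fl Nb ¬Nd with fl (outside-bottom-nbhd ¬Nd)
  ... | inj₁ refl = inj₂ (here refl)
  ... | inj₂ refl = inj₂ (there (here refl))

  module _ (3≤n : 3 ≤ n) where

    bottom-only-across : ∀ {b c d e v} → Flanked c d e → Adj b c →
      N (inj₂ b) v → ¬ N (inj₂ d) v → v ∈ inj₁ b ∷ inj₂ e ∷ []
    bottom-only-across fl bc Nb ¬Nd with bottom-only fl Nb ¬Nd | Nb
    ... | inj₁ refl                 | _                = here refl
    ... | inj₂ (here refl)          | inj₁ refl        = ⊥-elim (adj-irrefl 3≤n bc)
    ... | inj₂ (here refl)          | inj₂ (_ , b≁c)   = ⊥-elim (b≁c bc)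
    ... | inj₂ (there (here refl))  | _                = there (here refl)

  module _ {InD : Fin n ⊎ Fin n → Set} (code : IsIdentifyingCode (PrismAdj n Adj) InD) where
    open IsIdentifyingCode code

    Isolated : Fin n → Fin n → Fin n → Set
    Isolated p c s = ¬ Any InD (inj₁ c ∷ inj₂ p ∷ inj₂ s ∷ [])

    isolated-unseparated : ∀ {p c s p' c' s' v} → Flanked p' c' s' → Isolated p c s → Isolated p' c' s' →
      InD v → N (inj₂ c) v → ¬ N (inj₂ c') v → ⊥
    isolated-unseparated fl' iso iso' v∈D Nc ¬Nc' with bottom-only fl' Nc ¬Nc'
    ... | inj₁ refl   = iso (here v∈D)
    ... | inj₂ v∈p's' = iso' (there (lose v∈p's' v∈D))

    isolated-unique : ∀ {p c s p' c' s'} → c ≢ c' → Flanked p c s → Flanked p' c' s' →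
      Isolated p c s → Isolated p' c' s' → ⊥
    isolated-unique c≢c' fl fl' iso iso' with separating (inj₂ _) (inj₂ _) (c≢c' ∘ inj₂-injective)
    ... | v , v∈D , inj₁ (Nc , ¬Nc') = isolated-unseparated fl' iso iso' v∈D Nc ¬Nc'
    ... | v , v∈D , inj₂ (Nc' , ¬Nc) = isolated-unseparated fl iso' iso v∈D Nc' ¬Nc

module CyclicIndexing (n : ℕ) .{{_ : NonZero n}} where
  open Cycle n

  toℕ-mod : ∀ t → toℕ (t mod n) ≡ t % n
  toℕ-mod t = toℕ-fromℕ< (m%n<n t n)

  mod-periodic : ∀ t → (t + n) mod n ≡ t mod n
  mod-periodic t = toℕ-injective (trans (toℕ-mod (t + n)) (trans ([m+n]%n≡m%n t n) (sym (toℕ-mod t))))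

  toℕ-mod-inverse : ∀ i → toℕ i mod n ≡ i
  toℕ-mod-inverse i = toℕ-injective (trans (toℕ-mod (toℕ i)) (m<n⇒m%n≡m (toℕ<n i)))

  mod-injective : ∀ {t t'} → t < n → t' < n → t mod n ≡ t' mod n → t ≡ t'
  mod-injective {t} {t'} t<n t'<n eq = begin
    t       ≡⟨ m<n⇒m%n≡m t<n ⟨
    t % n   ≡⟨ trans (sym (toℕ-mod t)) (trans (cong toℕ eq) (toℕ-mod t')) ⟩
    t' % n  ≡⟨ m<n⇒m%n≡m t'<n ⟩
    t'      ∎
    where open ≡-Reasoning

  suc-% : ∀ t → suc t % n ≡ suc (t % n) % n
  suc-% t = begin
    (1 + t) % n                 ≡⟨ %-distribˡ-+ 1 t n ⟩
    (1 % n + t % n) % n         ≡⟨ cong (λ r → (1 % n + r) % n) (m%n%n≡m%n t n) ⟨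
    (1 % n + t % n % n) % n     ≡⟨ %-distribˡ-+ 1 (t % n) n ⟨
    (1 + t % n) % n             ∎
    where open ≡-Reasoning

  succ-mod : ∀ t → Succ (t mod n) (suc t mod n)
  succ-mod t rewrite toℕ-mod t | toℕ-mod (suc t) with suc (t % n) <? n
  ... | yes 1+r<n = inj₁ (sym (trans (suc-% t) (m<n⇒m%n≡m 1+r<n)))
  ... | no  1+r≮n = inj₂ (1+r≡n , trans (suc-% t) (trans (cong (_% n) 1+r≡n) (n%n≡0 n)))
    where
    1+r≡n : suc (t % n) ≡ n
    1+r≡n = ≤-antisym (m%n<n t n) (≮⇒≥ 1+r≮n)

module Reading (n : ℕ) (3≤n : 3 ≤ n) (D₁ D₂ : Subset n)
               (code : IsIdentifyingCode (PrismAdj n (CycleAdj n)) (InPair D₁ D₂)) where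

  instance
    n-nonZero : NonZero n
    n-nonZero = >-nonZero (≤-trans (s≤s z≤n) 3≤n)

  open Cycle n
  open Prism n
  open CyclicIndexing n
  open IdentifyingCode code

  x y : ℕ → Bool
  x t = lookup D₁ (t mod n)
  y t = lookup D₂ (t mod n)

  open Sequences x y

  inCode : Fin n ⊎ Fin n → Bool
  inCode (inj₁ i) = lookup D₁ i
  inCode (inj₂ i) = lookup D₂ i

  InPair⇒inCode : ∀ {v} → InPair D₁ D₂ v → T (inCode v)
  InPair⇒inCode {inj₁ i} i∈D₁ = subst T (sym ([]=⇒lookup i∈D₁)) tt
  InPair⇒inCode {inj₂ i} i∈D₂ = subst T (sym ([]=⇒lookup i∈D₂)) tt

  T-any-inCode : ∀ {L} → Any (InPair D₁ D₂) L → T (any inCode L)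
  T-any-inCode = any⁺ inCode ∘ Any.map InPair⇒inCode

  locally-identifying : LocallyIdentifying
  locally-identifying = record
    { dominated          = λ t → T-any-inCode (code-meets-nbhd-cover _ (top-nbhd (flanked (ab t) (bc t))))
    ; separated-adjacent = λ t → T-any-inCode (code-meets-difference-cover _ _
        (λ b≡c → succ-irrefl 3≤n (subst (Succ _) (sym (inj₁-injective b≡c)) (bc t)))
        (top-only-adjacent (flanked (ab t) (bc t)) (inj₂ (bc t)))
        (top-only-adjacent (flanked-swap (flanked (bc t) (cd t))) (inj₁ (bc t))))
    ; separated-across   = λ t → T-any-inCode (code-meets-difference-cover _ _
        (λ b≡d → succ-asym 3≤n (bc t) (subst (Succ _) (sym (inj₁-injective b≡d)) (cd t)))
        (top-only-across (flanked (ab t) (bc t)) (inj₂ (cd t)))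
        (top-only-across (flanked-swap (flanked (cd t) (de t))) (inj₁ (bc t))))
    ; separated-copies   = λ t → T-any-inCode (code-meets-difference-cover _ _
        (λ b≡d → succ-asym 3≤n (bc t) (subst (Succ _) (sym (inj₂-injective b≡d)) (cd t)))
        (bottom-only-across 3≤n (flanked (cd t) (de t)) (inj₁ (bc t)))
        (bottom-only-across 3≤n (flanked-swap (flanked (ab t) (bc t))) (inj₂ (cd t))))
    }
    where
    ab : ∀ t → Succ (t mod n) ((1 + t) mod n)
    bc : ∀ t → Succ ((1 + t) mod n) ((2 + t) mod n)
    cd : ∀ t → Succ ((2 + t) mod n) ((3 + t) mod n)
    de : ∀ t → Succ ((3 + t) mod n) ((4 + t) mod n)
    ab t = succ-mod t
    bc t = succ-mod (1 + t)
    cd t = succ-mod (2 + t)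
    de t = succ-mod (3 + t)

  isolated-at-most-once : ∀ {t t'} → t < n → t' < n → T (isolated t) → T (isolated t') → t ≡ t'
  isolated-at-most-once {t} {t'} t<n t'<n iso iso' with suc t mod n Fin.≟ suc t' mod n
  ... | yes c≡c' = mod-injective t<n t'<n (pred-unique (succ-mod t) (subst (Succ _) (sym c≡c') (succ-mod t')))
  ... | no  c≢c' = ⊥-elim (isolated-unique code c≢c'
                     (flanked (succ-mod t) (succ-mod (1 + t))) (flanked (succ-mod t') (succ-mod (1 + t')))
                     (T-not⇒¬T iso ∘ T-any-inCode) (T-not⇒¬T iso' ∘ T-any-inCode))

  ∑<-weight : ∑< n weight ≡ ∣ D₁ ∣ + ∣ D₂ ∣
  ∑<-weight = trans (∑<-+ n (bit ∘ x) (bit ∘ y))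
    (cong₂ _+_ (∑<-∣∣ D₁ (bit ∘ x) λ i → cong (bit ∘ lookup D₁) (toℕ-mod-inverse i))
               (∑<-∣∣ D₂ (bit ∘ y) λ i → cong (bit ∘ lookup D₂) (toℕ-mod-inverse i)))

  code-size-bound : 7 * n ≤ 9 * (∣ D₁ ∣ + ∣ D₂ ∣) + 7
  code-size-bound = subst (λ w → 7 * n ≤ 9 * w + 7) ∑<-weight
    (weight-bound n locally-identifying (cong (lookup D₁) ∘ mod-periodic) (cong (lookup D₂) ∘ mod-periodic)
      isolated-at-most-once)

lemma4 : (n : ℕ) → 9 ≤ n → (D₁ D₂ : Subset n) →
    IsIdentifyingCode (PrismAdj n (CycleAdj n)) (InPair D₁ D₂) →
    7 * n ≤ 9 * (∣ D₁ ∣ + ∣ D₂ ∣) + 108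
lemma4 n 9≤n D₁ D₂ code =
  ≤-trans (Reading.code-size-bound n (≤-trans (m≤m+n 3 6) 9≤n) D₁ D₂ code) (+-monoʳ-≤ _ (m≤m+n 7 101))
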